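{- Let $G$ be a finite simple undirected cubic (3-regular) graph and let $\varphi$ be an edge labeling of $G$. Then $$|V_{int}(G,\varphi)|\leq\left\lfloor\frac{3\cdot|V(G)|-2\cdot\eta(G[V_{int}(G,\varphi)])}{4}\right\rfloor.$$
   Context: An interval is a nonempty finite set of consecutive integers. An edge labeling of a graph $G$ is an injective function $\varphi:E(G)\to\{1,2,\dots,|E(G)|\}$. For a vertex $x$, its spectrum is $S_G(x,\varphi)=\{\varphi(e): e\in E(G),\ e \text{ incident with } x\}$, and $V_{int}(G,\varphi)=\{x\in V(G): S_G(x,\varphi)\text{ is an interval}\}$. For $V_0\subseteq V(G)$, $G[V_0]$ is the subgraph induced by $V_0$. For a graph $H$, $\eta(H)=0$ if $H$ has no vertices, and otherwise $\eta(H)$ is the number of connected components of $H$. -}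

module Defs where

open import Data.Nat using (ℕ; _≤_; _+_; _*_; _∸_; _/_)
open import Data.Fin using (Fin; toℕ; _≟_)
open import Data.Fin.Subset using (Subset; _∈_; ∣_∣)
open import Data.Vec using (count; allFin)
open import Data.Product using (_×_; _,_; proj₁; proj₂; Σ; ∃)
open import Data.Sum using (_⊎_)
open import Relation.Nullary.Decidable using (_⊎-dec_)
open import Relation.Nullary using (¬_; Dec)
open import Relation.Binary.PropositionalEquality using (_≡_; _≢_)
open import Function.Definitions using (Injective)

record Graph (n m : ℕ) : Set where
  field
    ends   : Fin m → Fin n × Fin n
    noLoop : ∀ e → proj₁ (ends e) ≢ proj₂ (ends e)
    simple : ∀ e f →
             ((proj₁ (ends e) ≡ proj₁ (ends f) × proj₂ (ends e) ≡ proj₂ (ends f))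
              ⊎ (proj₁ (ends e) ≡ proj₂ (ends f) × proj₂ (ends e) ≡ proj₁ (ends f)))
             → e ≡ f

module _ {n m : ℕ} (G : Graph n m) where
  open Graph G

  Incident : Fin m → Fin n → Set
  Incident e x = proj₁ (ends e) ≡ x ⊎ proj₂ (ends e) ≡ x

  incident? : ∀ e x → Dec (Incident e x)
  incident? e x = (proj₁ (ends e) ≟ x) ⊎-dec (proj₂ (ends e) ≟ x)

  degree : Fin n → ℕ
  degree x = count (λ e → incident? e x) (allFin m)

  Cubic : Set
  Cubic = ∀ x → degree x ≡ 3

  Adjacent : Fin n → Fin n → Set
  Adjacent x y = ∃ λ e → Incident e x × Incident e y × x ≢ y

  IsEdgeLabeling : (Fin m → ℕ) → Set
  IsEdgeLabeling φ = Injective _≡_ _≡_ φ × (∀ e → 1 ≤ φ e × φ e ≤ m)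

  InSpectrum : (Fin m → ℕ) → Fin n → ℕ → Set
  InSpectrum φ x k = ∃ λ e → Incident e x × φ e ≡ k

  SpectrumIsInterval : (Fin m → ℕ) → Fin n → Set
  SpectrumIsInterval φ x =
    Σ ℕ λ a → Σ ℕ λ b → a ≤ b ×
      (∀ k → (InSpectrum φ x k → a ≤ k × k ≤ b) × (a ≤ k × k ≤ b → InSpectrum φ x k))

  IsVint : (Fin m → ℕ) → Subset n → Set
  IsVint φ W = ∀ x → (x ∈ W → SpectrumIsInterval φ x) × (SpectrumIsInterval φ x → x ∈ W)

  data Reach (W : Subset n) : Fin n → Fin n → Set where
    here : ∀ {x} → x ∈ W → Reach W x x
    step : ∀ {x y z} → x ∈ W → Adjacent x y → Reach W y z → Reach W x z

  -- R is the set of representatives of components of G[W]: the vertices of W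
  -- that are the least-indexed vertex of their connected component in G[W].
  -- Hence ∣ R ∣ = η(G[W]) (= 0 when W is empty).
  IsComponentReps : Subset n → Subset n → Set
  IsComponentReps W R = ∀ x →
    (x ∈ R → x ∈ W × (∀ y → Reach W x y → toℕ x ≤ toℕ y)) ×
    (x ∈ W × (∀ y → Reach W x y → toℕ x ≤ toℕ y) → x ∈ R)

-- Call an edge e ascending at a vertex x when the label φ e + 1 also occurs at x.  At a cubic
-- vertex with interval spectrum every incident edge but the one with the largest label is
-- ascending, and since φ is injective and G simple, an edge is ascending at no more than one of
-- its ends; so the vertices of W use up 2|W| distinct edges.  In every component of G[W] the
-- edge of largest label touching the component is ascending at no vertex of W, and different
-- components yield different such edges.  Hence 2|W| + η(G[W]) ≤ |E(G)| = 3|V(G)|/2.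
module Submission where

open import Defs
open import Data.Nat using (ℕ; _≤_; _*_; _∸_; _/_)
open import Data.Fin using (Fin)
open import Data.Fin.Subset using (Subset; ∣_∣)

open import Data.Nat using (zero; suc; _+_; z≤n; s≤s; s≤s⁻¹; _≤?_) renaming (_≟_ to _≟ℕ_)
open import Data.Nat.Properties
  using (≤-refl; ≤-trans; ≤-reflexive; ≤-antisym; +-mono-≤; +-monoˡ-≤; +-monoʳ-≤; *-monoˡ-≤;
         m≤m+n; m≤n+m; n≤1+n; 1+n≢n; 1+n≰n; ≤∧≢⇒<; m+n≤o⇒m≤o∸n; +-comm; *-comm; *-identityʳ;
         +-0-commutativeMonoid; module ≤-Reasoning)
open import Data.Nat.DivMod using (/-monoˡ-≤; m*n/n≡m)
open import Data.Nat.Tactic.RingSolver using (solve-∀)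
open import Data.Fin using (zero; suc; toℕ; _≟_)
open import Data.Fin.Properties using (0≢1+n; suc-injective; toℕ-injective; any?; all?; ∀-cons)
open import Data.Fin.Subset using (_∈_; inside)
open import Data.Fin.Subset.Properties using (_∈?_)
open import Data.Vec using (count; tabulate; lookup)
open import Data.Vec.Properties using (tabulate∘lookup; []=⇒lookup; lookup⇒[]=)
import Data.Bool as Bool
import Data.List as List
open import Data.List.Membership.Propositional.Properties using (∈-filter⁺; ∈-allFin)
import Data.List.Relation.Unary.All as All
open import Data.List.Relation.Unary.All.Properties using (all-filter)
open import Data.List.Extrema.Nat using (argmax; argmax-all; f[xs]≤f[argmax])
open import Data.Product using (∃; _×_; _,_; proj₁; proj₂)
open import Data.Sum using (_⊎_; inj₁; inj₂)
open import Data.Empty using (⊥-elim)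
open import Function using (_∘_; _∘₂_; id; case_of_)
open import Function.Definitions using (Injective)
open import Relation.Nullary using (Dec; yes; no; ¬_)
open import Relation.Nullary.Decidable
  using (¬?; _×-dec_; _→-dec_; decidable-stable; ¬¬-excluded-middle)
open import Relation.Binary.PropositionalEquality using (_≡_; _≢_; refl; sym; trans; cong; cong₂; subst)
open import Algebra.Properties.CommutativeMonoid.Sum +-0-commutativeMonoid
  using (sum; sum-cong-≗; ∑-comm; ∑-distrib-+)

private variable
  A B C : Set
  n m : ℕ

𝟙 : Dec A → ℕ
𝟙 (yes _) = 1
𝟙 (no _)  = 0

𝟙-yes : (a? : Dec A) → A → 𝟙 a? ≡ 1
𝟙-yes (yes _) _ = refl
𝟙-yes (no ¬a) a = ⊥-elim (¬a a)

𝟙-mono : (a? : Dec A) (b? : Dec B) → (A → B) → 𝟙 a? ≤ 𝟙 b?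
𝟙-mono (yes a) (yes _) _   = ≤-refl
𝟙-mono (yes a) (no ¬b) a→b = ⊥-elim (¬b (a→b a))
𝟙-mono (no _)  _       _   = z≤n

𝟙-cong : (a? : Dec A) (b? : Dec B) → (A → B) → (B → A) → 𝟙 a? ≡ 𝟙 b?
𝟙-cong a? b? a→b b→a = ≤-antisym (𝟙-mono a? b? a→b) (𝟙-mono b? a? b→a)

𝟙-split : (a? : Dec A) (b? : Dec B) (c? : Dec C) → (A → B ⊎ C) → 𝟙 a? ≤ 𝟙 b? + 𝟙 c?
𝟙-split (no _)  _  _  _     = z≤n
𝟙-split (yes a) b? c? split with split a
... | inj₁ b = ≤-trans (≤-reflexive (sym (𝟙-yes b? b))) (m≤m+n _ _)
... | inj₂ c = ≤-trans (≤-reflexive (sym (𝟙-yes c? c))) (m≤n+m _ _)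

𝟙+𝟙¬≡1 : (a? : Dec A) → 𝟙 a? + 𝟙 (¬? a?) ≡ 1
𝟙+𝟙¬≡1 (yes _) = refl
𝟙+𝟙¬≡1 (no _)  = refl

∑-mono-≤ : {f g : Fin n → ℕ} → (∀ i → f i ≤ g i) → sum f ≤ sum g
∑-mono-≤ {zero}  f≤g = z≤n
∑-mono-≤ {suc n} f≤g = +-mono-≤ (f≤g zero) (∑-mono-≤ (f≤g ∘ suc))

∑-const : ∀ n c → sum {n} (λ _ → c) ≡ n * c
∑-const zero    c = refl
∑-const (suc n) c = cong (c +_) (∑-const n c)

∑-≥-single : (f : Fin n → ℕ) (i : Fin n) → f i ≤ sum f
∑-≥-single f zero    = m≤m+n (f zero) _
∑-≥-single f (suc i) = ≤-trans (∑-≥-single (f ∘ suc) i) (m≤n+m _ (f zero))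

∑-≥-pair : (f : Fin n → ℕ) {i j : Fin n} → i ≢ j → f i + f j ≤ sum f
∑-≥-pair f {zero}  {zero}  i≢j = ⊥-elim (i≢j refl)
∑-≥-pair f {zero}  {suc j} _   = +-monoʳ-≤ (f zero) (∑-≥-single (f ∘ suc) j)
∑-≥-pair f {suc i} {zero}  _   =
  ≤-trans (≤-reflexive (+-comm (f (suc i)) (f zero))) (+-monoʳ-≤ (f zero) (∑-≥-single (f ∘ suc) i))
∑-≥-pair f {suc i} {suc j} i≢j =
  ≤-trans (∑-≥-pair (f ∘ suc) (i≢j ∘ cong suc)) (m≤n+m _ (f zero))

double-counting : (f : Fin n → ℕ) (g : Fin m → ℕ) (T : Fin n → Fin m → ℕ) →
                  (∀ i → f i ≤ sum (T i)) → (∀ j → sum (λ i → T i j) ≤ g j) → sum f ≤ sum g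
double-counting f g T rows columns = begin
  sum f                         ≤⟨ ∑-mono-≤ rows ⟩
  sum (λ i → sum (T i))         ≡⟨ ∑-comm T ⟩
  sum (λ j → sum (λ i → T i j)) ≤⟨ ∑-mono-≤ columns ⟩
  sum g                         ∎
  where open ≤-Reasoning

∑𝟙-absent : {P : Fin n → Set} (P? : ∀ i → Dec (P i)) → (∀ i → ¬ P i) → sum (𝟙 ∘ P?) ≡ 0
∑𝟙-absent {zero}  P? _  = refl
∑𝟙-absent {suc n} P? ¬P with P? zero
... | yes p = ⊥-elim (¬P zero p)
... | no _  = ∑𝟙-absent (P? ∘ suc) (¬P ∘ suc)

∑𝟙≤1 : {P : Fin n → Set} (P? : ∀ i → Dec (P i)) → (∀ i j → P i → P j → i ≡ j) → sum (𝟙 ∘ P?) ≤ 1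
∑𝟙≤1 {zero}  P? _      = z≤n
∑𝟙≤1 {suc n} P? unique with P? zero
... | yes p = s≤s (≤-reflexive (∑𝟙-absent (P? ∘ suc) λ i q → 0≢1+n (unique zero (suc i) p q)))
... | no _  = ∑𝟙≤1 (P? ∘ suc) λ i j p q → suc-injective (unique (suc i) (suc j) p q)

module _ {P : Fin n → Set} (P? : ∀ i → Dec (P i)) where

  𝟙≤∑𝟙 : (a? : Dec A) → (A → ∃ P) → 𝟙 a? ≤ sum (𝟙 ∘ P?)
  𝟙≤∑𝟙 (no _)  _       = z≤n
  𝟙≤∑𝟙 (yes a) witness with witness a
  ... | i , p = ≤-trans (≤-reflexive (sym (𝟙-yes (P? i) p))) (∑-≥-single (𝟙 ∘ P?) i)

  ∑𝟙≤𝟙 : (b? : Dec B) → (∀ i → P i → B) → (∀ i j → P i → P j → i ≡ j) → sum (𝟙 ∘ P?) ≤ 𝟙 b?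
  ∑𝟙≤𝟙 (yes _) _   unique = ∑𝟙≤1 P? unique
  ∑𝟙≤𝟙 (no ¬b) P→B _      = ≤-reflexive (∑𝟙-absent P? (¬b ∘₂ P→B))

count-tabulate : {P : A → Set} (P? : ∀ a → Dec (P a)) (f : Fin n → A) →
                 count P? (tabulate f) ≡ sum (λ i → 𝟙 (P? (f i)))
count-tabulate {n = zero}  P? f = refl
count-tabulate {n = suc n} P? f with P? (f zero)
... | yes _ = cong suc (count-tabulate P? (f ∘ suc))
... | no _  = count-tabulate P? (f ∘ suc)

∣p∣≡∑𝟙∈ : (p : Subset n) → ∣ p ∣ ≡ sum (λ x → 𝟙 (x ∈? p))
∣p∣≡∑𝟙∈ p = trans (cong ∣_∣ (sym (tabulate∘lookup p)))
  (trans (count-tabulate (Bool._≟ inside) (lookup p))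
         (sum-cong-≗ λ x → 𝟙-cong (lookup p x Bool.≟ inside) (x ∈? p) (lookup⇒[]= x p) []=⇒lookup))

¬¬-Π : {P : Fin n → Set} → (∀ i → ¬ ¬ P i) → ¬ ¬ (∀ i → P i)
¬¬-Π {zero}  _   k = k λ ()
¬¬-Π {suc n} ¬¬P k = ¬¬P zero λ p → ¬¬-Π (¬¬P ∘ suc) λ ps → k (∀-cons p ps)

module _ (G : Graph n m) where
  open Graph G

  incident-ends : ∀ {e x y} → x ≢ y → Incident G e x → Incident G e y →
                  (proj₁ (ends e) ≡ x × proj₂ (ends e) ≡ y) ⊎ (proj₁ (ends e) ≡ y × proj₂ (ends e) ≡ x)
  incident-ends x≢y (inj₁ p) (inj₁ q) = ⊥-elim (x≢y (trans (sym p) q))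
  incident-ends x≢y (inj₁ p) (inj₂ q) = inj₁ (p , q)
  incident-ends x≢y (inj₂ p) (inj₁ q) = inj₂ (q , p)
  incident-ends x≢y (inj₂ p) (inj₂ q) = ⊥-elim (x≢y (trans (sym p) q))

  edge-determined-by-ends : ∀ {e f x y} → x ≢ y → Incident G e x → Incident G e y →
                            Incident G f x → Incident G f y → e ≡ f
  edge-determined-by-ends {e} {f} x≢y ex ey fx fy
    with incident-ends x≢y ex ey | incident-ends x≢y fx fy
  ... | inj₁ (p , q) | inj₁ (r , s) = simple e f (inj₁ (trans p (sym r) , trans q (sym s)))
  ... | inj₁ (p , q) | inj₂ (r , s) = simple e f (inj₂ (trans p (sym s) , trans q (sym r)))
  ... | inj₂ (p , q) | inj₁ (r , s) = simple e f (inj₂ (trans p (sym s) , trans q (sym r)))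
  ... | inj₂ (p , q) | inj₂ (r , s) = simple e f (inj₁ (trans p (sym r) , trans q (sym s)))

  degree≡∑𝟙 : ∀ x → degree G x ≡ sum (λ e → 𝟙 (incident? G e x))
  degree≡∑𝟙 x = count-tabulate (λ e → incident? G e x) id

  2m≤∑degree : m * 2 ≤ sum (degree G)
  2m≤∑degree = subst (_≤ sum (degree G)) (∑-const m 2)
    (double-counting (λ _ → 2) (degree G) incidence two-ends (λ x → ≤-reflexive (sym (degree≡∑𝟙 x))))
    where
    incidence : Fin m → Fin n → ℕ
    incidence e x = 𝟙 (incident? G e x)
    two-ends : ∀ e → 2 ≤ sum (incidence e)
    two-ends e = subst (_≤ sum (incidence e))
      (cong₂ _+_ (𝟙-yes (incident? G e _) (inj₁ refl)) (𝟙-yes (incident? G e _) (inj₂ refl)))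
      (∑-≥-pair (incidence e) (noLoop e))

  cubic⇒2m≤3n : Cubic G → m * 2 ≤ n * 3
  cubic⇒2m≤3n cubic = ≤-trans 2m≤∑degree (≤-reflexive (trans (sum-cong-≗ cubic) (∑-const n 3)))

  module _ {W : Subset n} where

    reach-∈ : ∀ {x y} → Reach G W x y → y ∈ W
    reach-∈ (here y∈W)     = y∈W
    reach-∈ (step _ _ x~y) = reach-∈ x~y

    reach-trans : ∀ {x y z} → Reach G W x y → Reach G W y z → Reach G W x z
    reach-trans (here _)         y~z = y~z
    reach-trans (step x∈W a x~y) y~z = step x∈W a (reach-trans x~y y~z)

    reach-edge : ∀ {x y e z} → Reach G W x y → Incident G e y → Incident G e z → z ∈ W →
                 Reach G W x z
    reach-edge {y = y} {z = z} x~y ey ez z∈W with y ≟ z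
    ... | yes refl = x~y
    ... | no y≢z   = reach-trans x~y (step (reach-∈ x~y) (_ , ey , ez , y≢z) (here z∈W))

    reach-sym : ∀ {x y} → Reach G W x y → Reach G W y x
    reach-sym (here x∈W)                       = here x∈W
    reach-sym (step x∈W (e , ex , ez , _) z~y) = reach-edge (reach-sym z~y) ez ex x∈W

module _ (G : Graph n m) (φ : Fin m → ℕ) where

  Ascending : Fin n → Fin m → Set
  Ascending x e = Incident G e x × InSpectrum G φ x (suc (φ e))

  ascending? : ∀ x e → Dec (Ascending x e)
  ascending? x e = incident? G e x ×-dec any? (λ d → incident? G d x ×-dec (φ d ≟ℕ suc (φ e)))

module _ (G : Graph n m) {φ : Fin m → ℕ} (φ-injective : Injective _≡_ _≡_ φ) where

  ascending-unique : ∀ {x y e} → Ascending G φ x e → Ascending G φ y e → x ≡ y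
  ascending-unique {x} {y} {e} (ex , d , dx , φd) (ey , d′ , d′y , φd′) with x ≟ y
  ... | yes x≡y = x≡y
  ... | no x≢y  = ⊥-elim (1+n≢n (sym (trans (cong φ e≡d) φd)))
    where
    d≡d′ : d ≡ d′
    d≡d′ = φ-injective (trans φd (sym φd′))
    e≡d : e ≡ d
    e≡d = edge-determined-by-ends G x≢y ex ey dx (subst (λ d → Incident G d y) (sym d≡d′) d′y)

  interval⇒degree≤1+ascending : ∀ {x} → SpectrumIsInterval G φ x →
                                degree G x ≤ 1 + sum (𝟙 ∘ ascending? G φ x)
  interval⇒degree≤1+ascending {x} (a , b , _ , spectrum) = begin
    degree G x                              ≡⟨ degree≡∑𝟙 G x ⟩
    sum (λ e → 𝟙 (incident? G e x))         ≤⟨ ∑-mono-≤ last-or-ascending ⟩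
    sum (λ e → 𝟙 (labelled-b e) + ascent e) ≡⟨ ∑-distrib-+ (𝟙 ∘ labelled-b) ascent ⟩
    sum (𝟙 ∘ labelled-b) + sum ascent       ≤⟨ +-monoˡ-≤ _ (∑𝟙≤1 labelled-b one-edge-labelled-b) ⟩
    1 + sum ascent                          ∎
    where
    open ≤-Reasoning
    labelled-b : ∀ e → Dec (φ e ≡ b)
    labelled-b e = φ e ≟ℕ b
    ascent : Fin m → ℕ
    ascent = 𝟙 ∘ ascending? G φ x
    one-edge-labelled-b : ∀ e e′ → φ e ≡ b → φ e′ ≡ b → e ≡ e′
    one-edge-labelled-b _ _ p q = φ-injective (trans p (sym q))
    last-or-ascending : ∀ e → 𝟙 (incident? G e x) ≤ 𝟙 (labelled-b e) + ascent e
    last-or-ascending e = 𝟙-split (incident? G e x) (labelled-b e) (ascending? G φ x e) λ ex →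
      let a≤φe , φe≤b = proj₁ (spectrum (φ e)) (e , ex , refl) in
      case labelled-b e of λ
        { (yes φe≡b) → inj₁ φe≡b
        ; (no φe≢b)  → inj₂ (ex , proj₂ (spectrum (suc (φ e)))
                                        (≤-trans a≤φe (n≤1+n _) , ≤∧≢⇒< φe≤b φe≢b))
        }

module _ (G : Graph n m) {φ : Fin m → ℕ} (φ-injective : Injective _≡_ _≡_ φ)
         {W R : Subset n} (vint : IsVint G φ W) (reps : IsComponentReps G W R)
         (reach? : ∀ x y → Dec (Reach G W x y)) where

  Touches : Fin n → Fin m → Set
  Touches r e = ∃ λ x → Reach G W r x × Incident G e x

  touches? : ∀ r e → Dec (Touches r e)
  touches? r e = any? (λ x → reach? r x ×-dec incident? G e x)

  TopEdge : Fin n → Fin m → Set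
  TopEdge r e = r ∈ R × Touches r e × (∀ e′ → Touches r e′ → φ e′ ≤ φ e)

  topEdge? : ∀ r e → Dec (TopEdge r e)
  topEdge? r e = (r ∈? R) ×-dec touches? r e ×-dec all? (λ e′ → touches? r e′ →-dec φ e′ ≤? φ e)

  rep∈W : ∀ {r} → r ∈ R → r ∈ W
  rep∈W {r} r∈R = proj₁ (proj₁ (reps r) r∈R)

  touches-some-edge : ∀ {r} → r ∈ R → ∃ (Touches r)
  touches-some-edge {r} r∈R with proj₁ (vint r) (rep∈W r∈R)
  ... | a , b , a≤b , spectrum with proj₂ (spectrum a) (≤-refl , a≤b)
  ... | e , re , _ = e , r , here (rep∈W r∈R) , re

  topEdge-exists : ∀ {r} → r ∈ R → ∃ (TopEdge r)
  topEdge-exists {r} r∈R with touches-some-edge r∈R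
  ... | e₀ , t₀ = argmax φ e₀ touching , r∈R , argmax-all φ t₀ (all-filter (touches? r) edges) , maximal
    where
    edges touching : List.List (Fin m)
    edges    = List.allFin m
    touching = List.filter (touches? r) edges
    maximal : ∀ e′ → Touches r e′ → φ e′ ≤ φ (argmax φ e₀ touching)
    maximal e′ t′ = All.lookup (f[xs]≤f[argmax] e₀ touching) (∈-filter⁺ (touches? r) (∈-allFin e′) t′)

  topEdge-unique : ∀ {r r′ e} → TopEdge r e → TopEdge r′ e → r ≡ r′
  topEdge-unique {r} {r′} (r∈R , (x , r~x , ex) , _) (r′∈R , (x′ , r′~x′ , ex′) , _) =
    toℕ-injective (≤-antisym (least r∈R r′ r~r′) (least r′∈R r (reach-sym G r~r′)))
    where
    least : ∀ {s} → s ∈ R → ∀ y → Reach G W s y → toℕ s ≤ toℕ y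
    least {s} s∈R = proj₂ (proj₁ (reps s) s∈R)
    r~r′ : Reach G W r r′
    r~r′ = reach-trans G (reach-edge G r~x ex ex′ (reach-∈ G r′~x′)) (reach-sym G r′~x′)

  topEdge-not-ascending : ∀ {r e x} → TopEdge r e → x ∈ W → ¬ Ascending G φ x e
  topEdge-not-ascending {e = e} (_ , (z , r~z , ez) , maximal) x∈W (ex , d , dx , φd≡1+φe) =
    1+n≰n (subst (_≤ φ e) φd≡1+φe (maximal d (_ , reach-edge G r~z ez ex x∈W , dx)))

  edge-budget : Cubic G → ∣ W ∣ + ∣ W ∣ + ∣ R ∣ ≤ m
  edge-budget cubic = begin
    ∣ W ∣ + ∣ W ∣ + ∣ R ∣              ≡⟨ cong₂ _+_ (cong₂ _+_ (∣p∣≡∑𝟙∈ W) (∣p∣≡∑𝟙∈ W)) (∣p∣≡∑𝟙∈ R) ⟩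
    sum 𝟙W + sum 𝟙W + sum 𝟙R           ≡⟨ cong (_+ sum 𝟙R) (∑-distrib-+ 𝟙W 𝟙W) ⟨
    sum (λ x → 𝟙W x + 𝟙W x) + sum 𝟙R   ≡⟨ ∑-distrib-+ (λ x → 𝟙W x + 𝟙W x) 𝟙R ⟨
    sum (λ x → 𝟙W x + 𝟙W x + 𝟙R x)     ≤⟨ double-counting _ (λ _ → 1) (λ x e → ascent x e + top x e)
                                                            row column ⟩
    sum {m} (λ _ → 1)                  ≡⟨ trans (∑-const m 1) (*-identityʳ m) ⟩
    m                                  ∎
    where
    open ≤-Reasoning
    𝟙W 𝟙R : Fin n → ℕ
    𝟙W x = 𝟙 (x ∈? W)
    𝟙R x = 𝟙 (x ∈? R)

    ascending∈W? : ∀ x e → Dec (x ∈ W × Ascending G φ x e)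
    ascending∈W? x e = (x ∈? W) ×-dec ascending? G φ x e

    ascent top : Fin n → Fin m → ℕ
    ascent x e = 𝟙 (ascending∈W? x e)
    top    x e = 𝟙 (topEdge? x e)

    two-ascents : ∀ x → (x∈W? : Dec (x ∈ W)) → 𝟙 x∈W? + 𝟙 x∈W? ≤ sum (ascent x)
    two-ascents x (no _)    = z≤n
    two-ascents x (yes x∈W) = begin
      2                ≤⟨ s≤s⁻¹ (subst (_≤ 1 + sum ascents) (cubic x) degree≤1+ascents) ⟩
      sum ascents      ≤⟨ ∑-mono-≤ (λ e → 𝟙-mono (ascending? G φ x e) (ascending∈W? x e) (x∈W ,_)) ⟩
      sum (ascent x)   ∎
      where
      ascents : Fin m → ℕ
      ascents = 𝟙 ∘ ascending? G φ x
      degree≤1+ascents : degree G x ≤ 1 + sum ascents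
      degree≤1+ascents = interval⇒degree≤1+ascending G φ-injective (proj₁ (vint x) x∈W)

    row : ∀ x → 𝟙W x + 𝟙W x + 𝟙R x ≤ sum (λ e → ascent x e + top x e)
    row x = ≤-trans (+-mono-≤ (two-ascents x (x ∈? W)) (𝟙≤∑𝟙 (topEdge? x) (x ∈? R) topEdge-exists))
                    (≤-reflexive (sym (∑-distrib-+ (ascent x) (top x))))

    column : ∀ e → sum (λ x → ascent x e + top x e) ≤ 1
    column e = begin
      sum (λ x → ascent x e + top x e)             ≡⟨ ∑-distrib-+ (λ x → ascent x e) (λ x → top x e) ⟩
      sum (λ x → ascent x e) + sum (λ x → top x e) ≤⟨ +-mono-≤ ascents tops ⟩
      𝟙 ascended? + 𝟙 (¬? ascended?)               ≡⟨ 𝟙+𝟙¬≡1 ascended? ⟩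
      1                                            ∎
      where
      ascended? : Dec (∃ λ x → x ∈ W × Ascending G φ x e)
      ascended? = any? (λ x → ascending∈W? x e)
      ascents : sum (λ x → ascent x e) ≤ 𝟙 ascended?
      ascents = ∑𝟙≤𝟙 (λ x → ascending∈W? x e) ascended? (λ x a → x , a)
                     (λ _ _ a b → ascending-unique G φ-injective (proj₂ a) (proj₂ b))
      tops : sum (λ x → top x e) ≤ 𝟙 (¬? ascended?)
      tops = ∑𝟙≤𝟙 (λ x → topEdge? x e) (¬? ascended?)
                  (λ _ t (x , x∈W , a) → topEdge-not-ascending t x∈W a) (λ _ _ → topEdge-unique)

budget⇒bound : ∀ {w r n m} → w + w + r ≤ m → m * 2 ≤ n * 3 → w ≤ (3 * n ∸ 2 * r) / 4
budget⇒bound {w} {r} {n} {m} budget handshake = begin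
  w                   ≡⟨ m*n/n≡m w 4 ⟨
  w * 4 / 4           ≤⟨ /-monoˡ-≤ 4 (m+n≤o⇒m≤o∸n (w * 4) 4w+2r≤3n) ⟩
  (3 * n ∸ 2 * r) / 4 ∎
  where
  open ≤-Reasoning
  doubled : ∀ w r → w * 4 + 2 * r ≡ (w + w + r) * 2
  doubled = solve-∀
  4w+2r≤3n : w * 4 + 2 * r ≤ 3 * n
  4w+2r≤3n = begin
    w * 4 + 2 * r    ≡⟨ doubled w r ⟩
    (w + w + r) * 2  ≤⟨ *-monoˡ-≤ 2 budget ⟩
    m * 2            ≤⟨ handshake ⟩
    n * 3            ≡⟨ *-comm n 3 ⟩
    3 * n            ∎

corollary2 : ∀ {n m : ℕ} (G : Graph n m) → Cubic G →
    (φ : Fin m → ℕ) → IsEdgeLabeling G φ →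
    (W : Subset n) → IsVint G φ W →
    (R : Subset n) → IsComponentReps G W R →
    ∣ W ∣ ≤ (3 * n ∸ 2 * ∣ R ∣) / 4
-- No decision procedure for Reach is at hand, but the goal is a decidable inequality, so it
-- may be proved under the double negation of the decidability of Reach, which holds outright.
corollary2 {n} G cubic φ (φ-injective , _) W vint R reps =
  decidable-stable (∣ W ∣ ≤? _) λ bound-fails →
    ¬¬-Π (λ _ → ¬¬-Π λ _ → ¬¬-excluded-middle) λ reach? →
      bound-fails (budget⇒bound {n = n} (edge-budget G φ-injective vint reps reach? cubic)
                                        (cubic⇒2m≤3n G cubic))
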